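{- Let $G_1,G_2$ be disjoint $2$-edge-connected graphs and $e_i\in E(G_i)$ with end vertices $u_i,v_i$ ($i=1,2$); let $G:=(G_1,e_1,u_1)\odot_E(G_2,e_2,u_2)$. Let $S\subseteq V(G_1)\cup E(G_1)$ and let $w_1,w_2\in V(G_1)$ be distinct. Set $S'=S$ if $e_1\notin S$ and $S'=(S\setminus\{e_1\})\cup\{f\}$ if $e_1\in S$, where $f$ is the new edge joining $u_1$ and $u_2$ in $G$. Then $S$ separates $w_1$ and $w_2$ in $G_1$ if and only if $S'$ separates $w_1$ and $w_2$ in $G$. In particular, $G$ is biconnected if and only if $G_1$ and $G_2$ are biconnected.
   Context: Graphs are finite, loopless, parallel edges allowed. A connected graph is $2$-edge-connected if it stays connected after removing any single edge; it is biconnected if connected with no cut-vertex. $(G_1,e_1,u_1)\odot_E(G_2,e_2,u_2)$ is obtained from $G_1\cup G_2$ by deleting $e_1,e_2$ and adding an edge between $u_1$ and $u_2$ and an edge between $v_1$ and $v_2$. A set $S$ of vertices and edges of a graph $H$ separates vertices $x,y$ if there is no $x$-$y$-path in $H$ containing no element of $S$. -}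

module Defs where

open import Data.Nat using (ℕ)
open import Data.Fin using (Fin)
open import Data.Bool using (Bool; true; false)
open import Data.Product using (Σ; _×_; _,_; proj₁; proj₂; ∃)
open import Data.Sum using (_⊎_; inj₁; inj₂)
open import Data.List using (List; []; _∷_)
open import Data.List.Relation.Unary.All using (All)
open import Data.List.Relation.Unary.Any using (Any)
open import Data.List.Membership.Propositional using (_∈_)
open import Data.List.Relation.Unary.Unique.Propositional using (Unique)
open import Relation.Binary.PropositionalEquality using (_≡_; _≢_; refl; cong)
open import Relation.Nullary using (¬_)
open import Function.Bundles using (_↔_)
open import Data.Empty using (⊥)

-- A multigraph: vertex set V, edge set E, each edge has two (distinct) ends.
-- Parallel edges are allowed (ends need not be injective); loops are not.
record Graph : Set₁ where
  field
    V : Set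
    E : Set
    ends : E → V × V
    loopless : ∀ e → proj₁ (ends e) ≢ proj₂ (ends e)
open Graph public

IsFinite : Graph → Set
IsFinite G = (Σ ℕ λ n → V G ↔ Fin n) × (Σ ℕ λ m → E G ↔ Fin m)

Joins : (G : Graph) → E G → V G → V G → Set
Joins G e x y = (ends G e ≡ (x , y)) ⊎ (ends G e ≡ (y , x))

data Walk (G : Graph) : V G → V G → Set where
  stop : (x : V G) → Walk G x x
  step : (x : V G) (e : E G) {y z : V G} → Joins G e x y → Walk G y z → Walk G x z

walkVertices : {G : Graph} {x y : V G} → Walk G x y → List (V G)
walkVertices (stop x) = x ∷ []
walkVertices (step x e _ w) = x ∷ walkVertices w

walkEdges : {G : Graph} {x y : V G} → Walk G x y → List (E G)
walkEdges (stop x) = []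
walkEdges (step x e _ w) = e ∷ walkEdges w

IsPath : {G : Graph} {x y : V G} → Walk G x y → Set
IsPath w = Unique (walkVertices w)

VESet : Graph → Set₁
VESet G = V G ⊎ E G → Set

Avoids : {G : Graph} {x y : V G} → VESet G → Walk G x y → Set
Avoids S w = All (λ v → ¬ S (inj₁ v)) (walkVertices w) × All (λ e → ¬ S (inj₂ e)) (walkEdges w)

Separates : (G : Graph) → VESet G → V G → V G → Set
Separates G S x y = ¬ (Σ (Walk G x y) λ p → IsPath p × Avoids S p)

Connected : Graph → Set
Connected G = V G × (∀ (x y : V G) → Σ (Walk G x y) IsPath)

TwoEdgeConnected : Graph → Set
TwoEdgeConnected G = Connected G ×
  (∀ (e : E G) (x y : V G) → Σ (Walk G x y) λ p → IsPath p × ¬ (e ∈ walkEdges p))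

IsCutVertex : (G : Graph) → V G → Set
IsCutVertex G c = Σ (V G) λ x → Σ (V G) λ y → x ≢ c × y ≢ c ×
  ¬ (Σ (Walk G x y) λ p → IsPath p × ¬ (c ∈ walkVertices p))

Biconnected : Graph → Set
Biconnected G = Connected G × (∀ (c : V G) → ¬ IsCutVertex G c)

-- Edges of (G₁,e₁,u₁) ⊙_E (G₂,e₂,u₂): old edges except e₁,e₂, plus two new
-- edges: true = f joining u₁ and u₂, false = the edge joining v₁ and v₂.
OdotEdge : (G₁ : Graph) → E G₁ → (G₂ : Graph) → E G₂ → Set
OdotEdge G₁ e₁ G₂ e₂ = (Σ (E G₁) λ e → e ≢ e₁) ⊎ (Σ (E G₂) λ e → e ≢ e₂) ⊎ Bool

private
  inj-ne : ∀ {A B : Set} {a b : A} → a ≢ b → _≢_ {A = A ⊎ B} (inj₁ a) (inj₁ b)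
  inj-ne ne refl = ne refl
  inj-ne₂ : ∀ {A B : Set} {a b : B} → a ≢ b → _≢_ {A = A ⊎ B} (inj₂ a) (inj₂ b)
  inj-ne₂ ne refl = ne refl
  lr : ∀ {A B : Set} {a : A} {b : B} → _≢_ {A = A ⊎ B} (inj₁ a) (inj₂ b)
  lr ()
  rl : ∀ {A B : Set} {a : A} {b : B} → _≢_ {A = A ⊎ B} (inj₂ b) (inj₁ a)
  rl ()

-- (G₁,e₁,u₁) ⊙_E (G₂,e₂,u₂), where v₁, v₂ are the other ends of e₁, e₂
-- (passed explicitly; the theorem assumes Joins G₁ e₁ u₁ v₁, Joins G₂ e₂ u₂ v₂).
odotE : (G₁ : Graph) (e₁ : E G₁) (u₁ v₁ : V G₁)
        (G₂ : Graph) (e₂ : E G₂) (u₂ v₂ : V G₂) → Graph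
odotE G₁ e₁ u₁ v₁ G₂ e₂ u₂ v₂ = record
  { V = V G₁ ⊎ V G₂
  ; E = OdotEdge G₁ e₁ G₂ e₂
  ; ends = en
  ; loopless = ll
  }
  where
  en : OdotEdge G₁ e₁ G₂ e₂ → (V G₁ ⊎ V G₂) × (V G₁ ⊎ V G₂)
  en (inj₁ (e , _)) = inj₁ (proj₁ (ends G₁ e)) , inj₁ (proj₂ (ends G₁ e))
  en (inj₂ (inj₁ (e , _))) = inj₂ (proj₁ (ends G₂ e)) , inj₂ (proj₂ (ends G₂ e))
  en (inj₂ (inj₂ true)) = inj₁ u₁ , inj₂ u₂
  en (inj₂ (inj₂ false)) = inj₁ v₁ , inj₂ v₂
  ll : ∀ e → proj₁ (en e) ≢ proj₂ (en e)
  ll (inj₁ (e , _)) = inj-ne (loopless G₁ e)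
  ll (inj₂ (inj₁ (e , _))) = inj-ne₂ (loopless G₂ e)
  ll (inj₂ (inj₂ true)) = lr
  ll (inj₂ (inj₂ false)) = lr

liftSet : (G₁ : Graph) (e₁ : E G₁) (u₁ v₁ : V G₁)
          (G₂ : Graph) (e₂ : E G₂) (u₂ v₂ : V G₂) →
          VESet G₁ → VESet (odotE G₁ e₁ u₁ v₁ G₂ e₂ u₂ v₂)
liftSet G₁ e₁ u₁ v₁ G₂ e₂ u₂ v₂ S (inj₁ (inj₁ v)) = S (inj₁ v)
liftSet G₁ e₁ u₁ v₁ G₂ e₂ u₂ v₂ S (inj₁ (inj₂ v)) = ⊥
liftSet G₁ e₁ u₁ v₁ G₂ e₂ u₂ v₂ S (inj₂ (inj₁ (e , _))) = S (inj₂ e)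
liftSet G₁ e₁ u₁ v₁ G₂ e₂ u₂ v₂ S (inj₂ (inj₂ (inj₁ _))) = ⊥
liftSet G₁ e₁ u₁ v₁ G₂ e₂ u₂ v₂ S (inj₂ (inj₂ (inj₂ true))) = S (inj₂ e₁)
liftSet G₁ e₁ u₁ v₁ G₂ e₂ u₂ v₂ S (inj₂ (inj₂ (inj₂ false))) = ⊥

module Submission where

-- The argument works with restricted walks (walks whose vertices and edges
-- satisfy given predicates); for graphs with decidable vertex equality, such
-- as finite ones, a restricted walk can be shortened to a restricted path, so
-- separation and cut-vertices may be described by walks instead of paths.
-- The heart of the proof is a pair of walk transformations between G₁ and G:
--   * projection: an excursion of a G-walk into G₂ leaves and re-enters G₁
--     through f = u₁u₂ or g = v₁v₂, so it can be replaced by e₁ (or dropped);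
--   * embedding: a use of e₁ is replaced by u₁ f (path in G₂ − e₂) g v₁,
--     which exists because G₂ is 2-edge-connected.
-- Both respect a restriction on G₁ when f carries the restriction of e₁,
-- which is exactly how S' is formed; this gives the separation statement.
-- For biconnectivity the transformations carry walks avoiding a vertex; the
-- claims about G₂ follow from those about G₁ by exchanging the factors,
-- which is an isomorphism of the glued graphs.

open import Defs
open import Data.Bool using (true; false)
open import Data.Fin using (Fin)
import Data.Fin.Properties as Fin
open import Data.List using ([]; _∷_)
open import Data.List.Membership.Propositional using (_∈_)
import Data.List.Membership.DecPropositional as DecMembership
open import Data.List.Relation.Binary.Subset.Propositional using (_⊆_)
open import Data.List.Relation.Unary.All using (All; []; _∷_; universal-U)
open import Data.List.Relation.Unary.All.Properties using (anti-mono; ¬Any⇒All¬; All¬⇒¬Any)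
open import Data.List.Relation.Unary.AllPairs using ([]; _∷_)
open import Data.List.Relation.Unary.Any using (here; there)
open import Data.List.Relation.Unary.Unique.Propositional using (Unique)
open import Data.Nat using (ℕ)
open import Data.Product using (Σ; _×_; _,_; proj₁; proj₂)
import Data.Product as Product
open import Data.Product.Properties using (×-≡,≡←≡)
open import Data.Sum using (_⊎_; inj₁; inj₂; [_,_]′; swap)
open import Data.Sum.Properties using (≡-dec; swap-involutive; inj₁-injective; inj₂-injective)
open import Data.Unit using (⊤; tt)
open import Function using (_∘_; id)
open import Function.Bundles using (_⇔_; mk⇔; _↔_)
open import Function.Construct.Composition using (_⇔-∘_)
open import Function.Construct.Symmetry using (⇔-sym)
open import Function.Properties.Inverse using (↔⇒↣)
open import Relation.Binary.Definitions using (DecidableEquality)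
open import Relation.Binary.PropositionalEquality
  using (_≡_; _≢_; refl; sym; trans; cong; subst₂; ≢-sym)
open import Relation.Nullary using (¬_; yes; no)
open import Relation.Nullary.Decidable using (via-injection)
open import Relation.Unary using (U)

joins-sym : {H : Graph} {e : E H} {x y : V H} → Joins H e x y → Joins H e y x
joins-sym (inj₁ eq) = inj₂ eq
joins-sym (inj₂ eq) = inj₁ eq

joins-distinct : {H : Graph} {e : E H} {x y : V H} → Joins H e x y → x ≢ y
joins-distinct {H} {e} (inj₁ refl) = loopless H e
joins-distinct {H} {e} (inj₂ refl) = loopless H e ∘ sym

joins-unique : {H : Graph} {e : E H} {u v x y : V H} → Joins H e u v → Joins H e x y →
  ((x ≡ u) × (y ≡ v)) ⊎ ((x ≡ v) × (y ≡ u))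
joins-unique (inj₁ uv) (inj₁ xy) = inj₁ (×-≡,≡←≡ (trans (sym xy) uv))
joins-unique (inj₁ uv) (inj₂ yx) = inj₂ (Product.swap (×-≡,≡←≡ (trans (sym yx) uv)))
joins-unique (inj₂ vu) (inj₁ xy) = inj₂ (×-≡,≡←≡ (trans (sym xy) vu))
joins-unique (inj₂ vu) (inj₂ yx) = inj₁ (Product.swap (×-≡,≡←≡ (trans (sym yx) vu)))

joins-image : (G H : Graph) (φ : V G → V H) {e : E G} {e' : E H} {x y : V G} →
  ends H e' ≡ Product.map φ φ (ends G e) → Joins G e x y → Joins H e' (φ x) (φ y)
joins-image G H φ eq (inj₁ xy) = inj₁ (trans eq (cong (Product.map φ φ) xy))
joins-image G H φ eq (inj₂ yx) = inj₂ (trans eq (cong (Product.map φ φ) yx))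

joins-image-flipped : (G H : Graph) (φ : V G → V H) {e : E G} {e' : E H} {x y : V G} →
  ends H e' ≡ Product.swap (Product.map φ φ (ends G e)) → Joins G e x y → Joins H e' (φ x) (φ y)
joins-image-flipped G H φ eq (inj₁ xy) = inj₂ (trans eq (cong (Product.swap ∘ Product.map φ φ) xy))
joins-image-flipped G H φ eq (inj₂ yx) = inj₁ (trans eq (cong (Product.swap ∘ Product.map φ φ) yx))

joins-preimage : (G H : Graph) (φ : V G → V H) → (∀ {a b} → φ a ≡ φ b → a ≡ b) →
  {e : E G} {e' : E H} {x : V G} {y : V H} →
  ends H e' ≡ Product.map φ φ (ends G e) → Joins H e' (φ x) y →
  Σ (V G) λ b → (y ≡ φ b) × Joins G e x b
joins-preimage G H φ injective {e} eq (inj₁ xy) with ×-≡,≡←≡ (trans (sym eq) xy)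
... | a≡x , b≡y = proj₂ (ends G e) , sym b≡y , inj₁ (cong (_, proj₂ (ends G e)) (injective a≡x))
joins-preimage G H φ injective {e} eq (inj₂ yx) with ×-≡,≡←≡ (trans (sym eq) yx)
... | a≡y , b≡x = proj₁ (ends G e) , sym a≡y , inj₂ (cong (proj₁ (ends G e) ,_) (injective b≡x))

-- Restricted walks: walks all of whose vertices satisfy P and all of whose
-- edges satisfy Q.  Avoiding a set, or a vertex, is such a restriction.
data RWalk (G : Graph) (P : V G → Set) (Q : E G → Set) : V G → V G → Set where
  done : ∀ {x} → P x → RWalk G P Q x x
  via  : ∀ {x y z} (e : E G) → P x → Q e → Joins G e x y → RWalk G P Q y z → RWalk G P Q x z

module _ {G : Graph} {P : V G → Set} {Q : E G → Set} where

  first : ∀ {x y} → RWalk G P Q x y → P x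
  first (done p) = p
  first (via _ p _ _ _) = p

  infixr 5 _++_
  _++_ : ∀ {x y z} → RWalk G P Q x y → RWalk G P Q y z → RWalk G P Q x z
  done _ ++ w' = w'
  via e p q j w ++ w' = via e p q j (w ++ w')

  reverseOnto : ∀ {x y z} → RWalk G P Q x y → RWalk G P Q x z → RWalk G P Q y z
  reverseOnto (done _) acc = acc
  reverseOnto (via e _ q j w) acc = reverseOnto w (via e (first w) q (joins-sym {G} j) acc)

  reverse : ∀ {x y} → RWalk G P Q x y → RWalk G P Q y x
  reverse w = reverseOnto w (done (first w))

record Morphism (G H : Graph) (R : E G → Set) : Set where
  field
    onV   : V G → V H
    onE   : ∀ e → R e → E H
    joins : ∀ {e x y} (r : R e) → Joins G e x y → Joins H (onE e r) (onV x) (onV y)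
open Morphism

transfer : {G H : Graph} {P : V G → Set} {Q : E G → Set} {P' : V H → Set} {Q' : E H → Set}
  (m : Morphism G H Q) → (∀ x → P x → P' (onV m x)) → (∀ e (q : Q e) → Q' (onE m e q)) →
  ∀ {x y} → RWalk G P Q x y → RWalk H P' Q' (onV m x) (onV m y)
transfer m f g (done p) = done (f _ p)
transfer m f g (via e p q j w) = via (onE m e q) (f _ p) (g e q) (joins m q j) (transfer m f g w)

identity : {G : Graph} {Q : E G → Set} → Morphism G G Q
onV identity = id
onE identity e _ = e
joins identity _ j = j

weaken : {G : Graph} {P P' : V G → Set} {Q Q' : E G → Set} →
  (∀ x → P x → P' x) → (∀ e → Q e → Q' e) → ∀ {x y} → RWalk G P Q x y → RWalk G P' Q' x y
weaken f g = transfer identity f g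

fromWalk : {G : Graph} {P : V G → Set} {Q : E G → Set} {x y : V G} (w : Walk G x y) →
  All P (walkVertices w) → All Q (walkEdges w) → RWalk G P Q x y
fromWalk (stop x) (p ∷ []) [] = done p
fromWalk (step x e j w) (p ∷ ps) (q ∷ qs) = via e p q j (fromWalk w ps qs)

toWalk : {G : Graph} {P : V G → Set} {Q : E G → Set} {x y : V G} → RWalk G P Q x y →
  Σ (Walk G x y) λ w → All P (walkVertices w) × All Q (walkEdges w)
toWalk (done {x} p) = stop x , p ∷ [] , []
toWalk (via {x} e p q j w) with toWalk w
... | w' , ps , qs = step x e j w' , p ∷ ps , q ∷ qs

module _ {G : Graph} where

  suffixFrom : ∀ {x y z} (w : Walk G y z) → x ∈ walkVertices w →
    Σ (Walk G x z) λ s → walkVertices s ⊆ walkVertices w × walkEdges s ⊆ walkEdges w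
      × (Unique (walkVertices w) → Unique (walkVertices s))
  suffixFrom (stop y) (here refl) = stop y , id , id , id
  suffixFrom (step y e j w) (here refl) = step y e j w , id , id , id
  suffixFrom (step y e j w) (there x∈w) with suffixFrom w x∈w
  ... | s , sv , se , su = s , there ∘ sv , there ∘ se , λ { (_ ∷ u) → su u }

  module _ (_≟_ : DecidableEquality (V G)) where
    open DecMembership _≟_ using (_∈?_)

    -- Whenever the walk revisits its first vertex, cut out the closed part.
    shortcut : ∀ {x y} (w : Walk G x y) →
      Σ (Walk G x y) λ p → IsPath p × walkVertices p ⊆ walkVertices w × walkEdges p ⊆ walkEdges w
    shortcut (stop x) = stop x , [] ∷ [] , id , id
    shortcut (step x e j w) with shortcut w
    ... | p , path , pv , pe with x ∈? walkVertices p
    ...   | yes x∈p with suffixFrom p x∈p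
    ...     | s , sv , se , su = s , su path , there ∘ pv ∘ sv , there ∘ pe ∘ se
    shortcut (step x e j w) | p , path , pv , pe | no x∉p =
      step x e j p , ¬Any⇒All¬ _ x∉p ∷ path ,
      (λ { (here eq) → here eq ; (there k) → there (pv k) }) ,
      (λ { (here eq) → here eq ; (there k) → there (pe k) })

    toPath : ∀ {P : V G → Set} {Q : E G → Set} {x y} → RWalk G P Q x y →
      Σ (Walk G x y) λ p → IsPath p × All P (walkVertices p) × All Q (walkEdges p)
    toPath w with toWalk w
    ... | w' , ps , qs with shortcut w'
    ... | p , path , pv , pe = p , path , anti-mono pv ps , anti-mono pe qs

finite⇒decidable : {A : Set} → Σ ℕ (λ n → A ↔ Fin n) → DecidableEquality A
finite⇒decidable (n , A↔Fin) = via-injection (↔⇒↣ A↔Fin) Fin._≟_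

AvoidingWalk : (H : Graph) → VESet H → V H → V H → Set
AvoidingWalk H S = RWalk H (λ v → ¬ S (inj₁ v)) (λ e → ¬ S (inj₂ e))

separates⇔ : (H : Graph) → DecidableEquality (V H) → ∀ S x y →
  Separates H S x y ⇔ (¬ AvoidingWalk H S x y)
separates⇔ H dec S x y = mk⇔
  (λ sep w → sep (toPath dec w))
  (λ noWalk (p , _ , avoids) → noWalk (fromWalk p (proj₁ avoids) (proj₂ avoids)))

walks-of-connected : (H : Graph) → Connected H → ∀ x y → RWalk H U U x y
walks-of-connected H (_ , paths) x y = fromWalk p (universal-U _) (universal-U _)
  where
  p : Walk H x y
  p = proj₁ (paths x y)

connected-of-walks : (H : Graph) → DecidableEquality (V H) → V H →
  (∀ x y → RWalk H U U x y) → Connected H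
connected-of-walks H dec v walks = v , λ x y →
  let (p , path , _) = toPath dec (walks x y) in p , path

walks-avoiding : (H : Graph) → TwoEdgeConnected H → ∀ e x y → RWalk H U (e ≢_) x y
walks-avoiding H (_ , paths) e x y = fromWalk p (universal-U _) (¬Any⇒All¬ _ e∉p)
  where
  p : Walk H x y
  p = proj₁ (paths e x y)
  e∉p : ¬ (e ∈ walkEdges p)
  e∉p = proj₂ (proj₂ (paths e x y))

-- c is no cut-vertex: any two other vertices are joined by a walk avoiding c.
-- (The double negation keeps the notion equivalent to ¬ IsCutVertex
-- constructively.)
NoCutAt : (H : Graph) → V H → Set
NoCutAt H c = ∀ x y → x ≢ c → y ≢ c → ¬ ¬ RWalk H (c ≢_) U x y

no-cut⇒NoCutAt : (H : Graph) → ∀ c → ¬ IsCutVertex H c → NoCutAt H c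
no-cut⇒NoCutAt H c noCut x y x≢c y≢c noWalk =
  noCut (x , y , x≢c , y≢c , λ (p , path , c∉p) → noWalk (fromWalk p (¬Any⇒All¬ _ c∉p) (universal-U _)))

NoCutAt⇒no-cut : (H : Graph) → DecidableEquality (V H) → ∀ c → NoCutAt H c → ¬ IsCutVertex H c
NoCutAt⇒no-cut H dec c noCut (x , y , x≢c , y≢c , noPath) = noCut x y x≢c y≢c λ w →
  let (p , path , avoids , _) = toPath dec w in noPath (p , path , All¬⇒¬Any avoids)

noCutAt-transfer : {H K : Graph} (m : Morphism H K U) (φ⁻¹ : V K → V H) →
  (∀ x → onV m (φ⁻¹ x) ≡ x) → (∀ v → φ⁻¹ (onV m v) ≡ v) →
  ∀ c → NoCutAt H (φ⁻¹ c) → NoCutAt K c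
noCutAt-transfer {K = K} m φ⁻¹ right left c noCut x y x≢c y≢c noWalk =
  noCut (φ⁻¹ x) (φ⁻¹ y) (x≢c ∘ reflect) (y≢c ∘ reflect) λ w →
    noWalk (subst₂ (RWalk K (c ≢_) U) (right x) (right y) (transfer m avoid (λ _ _ → tt) w))
  where
  reflect : ∀ {z} → φ⁻¹ z ≡ φ⁻¹ c → z ≡ c
  reflect {z} eq = trans (sym (right z)) (trans (cong (onV m) eq) (right c))
  avoid : ∀ v → φ⁻¹ c ≢ v → c ≢ onV m v
  avoid v c≢v eq = c≢v (trans (cong φ⁻¹ eq) (left v))

-- The graph G = (G₁,e₁,u₁) ⊙_E (G₂,e₂,u₂).  Everything here concerns the
-- first factor G₁; statements about G₂ follow by exchanging the factors.
module Odot (G₁ : Graph) (e₁ : E G₁) (u₁ v₁ : V G₁)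
            (G₂ : Graph) (e₂ : E G₂) (u₂ v₂ : V G₂) where

  G : Graph
  G = odotE G₁ e₁ u₁ v₁ G₂ e₂ u₂ v₂

  G' : Graph
  G' = odotE G₂ e₂ u₂ v₂ G₁ e₁ u₁ v₁

  f g : E G
  f = inj₂ (inj₂ true)
  g = inj₂ (inj₂ false)

  -- Restrictions on G induced by restrictions P, Q on G₁: the vertices and
  -- edges of G₂ and the edge g are unrestricted, f inherits the restriction
  -- of e₁ (just as S' puts f in place of e₁).
  liftV : (V G₁ → Set) → V G → Set
  liftV P = [ P , U ]′

  liftE : (E G₁ → Set) → E G → Set
  liftE Q (inj₁ (e , _)) = Q e
  liftE Q (inj₂ (inj₁ _)) = ⊤
  liftE Q (inj₂ (inj₂ true)) = Q e₁
  liftE Q (inj₂ (inj₂ false)) = ⊤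

  liftE-U : ∀ e → liftE U e
  liftE-U (inj₁ _) = tt
  liftE-U (inj₂ (inj₁ _)) = tt
  liftE-U (inj₂ (inj₂ true)) = tt
  liftE-U (inj₂ (inj₂ false)) = tt

  inclusion₂ : Morphism G₂ G (e₂ ≢_)
  inclusion₂ = record
    { onV = inj₂
    ; onE = λ e e₂≢e → inj₂ (inj₁ (e , ≢-sym e₂≢e))
    ; joins = λ {e} e₂≢e → joins-image G₂ G inj₂ {e = e} {e' = inj₂ (inj₁ (e , ≢-sym e₂≢e))} refl
    }

  lift₂ : ∀ {P Q a b} → RWalk G₂ U (e₂ ≢_) a b → RWalk G (liftV P) (liftE Q) (inj₂ a) (inj₂ b)
  lift₂ = transfer inclusion₂ (λ _ _ → tt) (λ _ _ → tt)

  exchangeE : E G → E G'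
  exchangeE (inj₁ e) = inj₂ (inj₁ e)
  exchangeE (inj₂ (inj₁ e)) = inj₁ e
  exchangeE (inj₂ (inj₂ b)) = inj₂ (inj₂ b)

  exchange-joins : ∀ {e x y} → Joins G e x y → Joins G' (exchangeE e) (swap x) (swap y)
  exchange-joins {inj₁ e} = joins-image G G' swap {e = inj₁ e} {e' = inj₂ (inj₁ e)} refl
  exchange-joins {inj₂ (inj₁ e)} = joins-image G G' swap {e = inj₂ (inj₁ e)} {e' = inj₁ e} refl
  exchange-joins {inj₂ (inj₂ true)} = joins-image-flipped G G' swap {e = f} {e' = inj₂ (inj₂ true)} refl
  exchange-joins {inj₂ (inj₂ false)} = joins-image-flipped G G' swap {e = g} {e' = inj₂ (inj₂ false)} refl

  exchange : Morphism G G' U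
  exchange = record { onV = swap ; onE = λ e _ → exchangeE e ; joins = λ _ → exchange-joins }

  noCutAt-exchange : ∀ c → NoCutAt G (swap c) → NoCutAt G' c
  noCutAt-exchange = noCutAt-transfer exchange swap swap-involutive swap-involutive

  -- Projection: a walk in G between vertices of G₁ becomes a walk in G₁ by
  -- replacing each excursion into G₂ by e₁ (or by nothing, if it returns
  -- through the edge it left by).  An excursion using f carries the
  -- restriction of e₁.
  module Projection {P : V G₁ → Set} {Q : E G₁ → Set} (j₁ : Joins G₁ e₁ u₁ v₁) where

    project : ∀ {x y} → RWalk G (liftV P) (liftE Q) (inj₁ x) (inj₁ y) → RWalk G₁ P Q x y

    -- A walk from G₂ into G₁ re-enters G₁ through f (at u₁) or through g (at v₁).
    reenter : ∀ {a y} → RWalk G (liftV P) (liftE Q) (inj₂ a) (inj₁ y) →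
      (Q e₁ × RWalk G₁ P Q u₁ y) ⊎ RWalk G₁ P Q v₁ y

    project (done p) = done p
    project (via (inj₁ (e , e≢e₁)) p q j w)
      with joins-preimage G₁ G inj₁ inj₁-injective {e = e} {e' = inj₁ (e , e≢e₁)} refl j
    ... | _ , refl , j' = via e p q j' (project w)
    project (via (inj₂ (inj₁ _)) _ _ (inj₁ ()) _)
    project (via (inj₂ (inj₁ _)) _ _ (inj₂ ()) _)
    project (via (inj₂ (inj₂ true)) p q (inj₁ refl) w) with reenter w
    ... | inj₁ (_ , w') = w'
    ... | inj₂ w' = via e₁ p q j₁ w'
    project (via (inj₂ (inj₂ false)) p _ (inj₁ refl) w) with reenter w
    ... | inj₁ (q , w') = via e₁ p q (joins-sym {G₁} j₁) w'
    ... | inj₂ w' = w'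

    reenter (via (inj₁ _) _ _ (inj₁ ()) _)
    reenter (via (inj₁ _) _ _ (inj₂ ()) _)
    reenter (via (inj₂ (inj₁ (e , e≢e₂))) _ _ j w)
      with joins-preimage G₂ G inj₂ inj₂-injective {e = e} {e' = inj₂ (inj₁ (e , e≢e₂))} refl j
    ... | _ , refl , _ = reenter w
    reenter (via (inj₂ (inj₂ true)) _ q (inj₂ refl) w) = inj₁ (q , project w)
    reenter (via (inj₂ (inj₂ false)) _ _ (inj₂ refl) w) = inj₂ (project w)

  -- Embedding: a walk in G₁ becomes a walk in G by replacing each use of e₁
  -- by the detour u₁ –f– (a walk in G₂ − e₂) –g– v₁.
  module Embedding {P : V G₁ → Set} {Q : E G₁ → Set} (j₁ : Joins G₁ e₁ u₁ v₁)
    (_≟_ : DecidableEquality (E G₁)) (link : RWalk G₂ U (e₂ ≢_) u₂ v₂) where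

    detour : P u₁ → P v₁ → Q e₁ → RWalk G (liftV P) (liftE Q) (inj₁ u₁) (inj₁ v₁)
    detour pu pv q = via f pu q (inj₁ refl) (lift₂ link ++ via g tt tt (inj₂ refl) (done pv))

    embed : ∀ {x y} → RWalk G₁ P Q x y → RWalk G (liftV P) (liftE Q) (inj₁ x) (inj₁ y)
    embed (done p) = done p
    embed (via e p q j w) with e ≟ e₁
    ... | no e≢e₁ = via (inj₁ (e , e≢e₁)) p q (joins-image G₁ G inj₁ {e = e} {e' = inj₁ (e , e≢e₁)} refl j) (embed w)
    ... | yes refl with joins-unique {G₁} j₁ j
    ...   | inj₁ (refl , refl) = detour p (first w) q ++ embed w
    ...   | inj₂ (refl , refl) = reverse (detour (first w) p q) ++ embed w

  -- Theorem 10, separation part: S separates w₁, w₂ in G₁ iff S' does in G.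
  separation : DecidableEquality (V G₁) → DecidableEquality (V G₂) → DecidableEquality (E G₁) →
    Joins G₁ e₁ u₁ v₁ → RWalk G₂ U (e₂ ≢_) u₂ v₂ → ∀ S w₁ w₂ →
    Separates G₁ S w₁ w₂ ⇔ Separates G (liftSet G₁ e₁ u₁ v₁ G₂ e₂ u₂ v₂ S) (inj₁ w₁) (inj₁ w₂)
  separation decV₁ decV₂ decE₁ j₁ link S w₁ w₂ =
    ⇔-sym (separates⇔ G (≡-dec decV₁ decV₂) S' (inj₁ w₁) (inj₁ w₂))
      ⇔-∘ (same-walks ⇔-∘ separates⇔ G₁ decV₁ S w₁ w₂)
    where
    S' : VESet G
    S' = liftSet G₁ e₁ u₁ v₁ G₂ e₂ u₂ v₂ S
    open Projection j₁
    open Embedding j₁ decE₁ link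

    avoidsV : ∀ v → ¬ S' (inj₁ v) → liftV (λ a → ¬ S (inj₁ a)) v
    avoidsV (inj₁ _) h = h
    avoidsV (inj₂ _) _ = tt

    avoidsE : ∀ e → ¬ S' (inj₂ e) → liftE (λ a → ¬ S (inj₂ a)) e
    avoidsE (inj₁ _) h = h
    avoidsE (inj₂ (inj₁ _)) _ = tt
    avoidsE (inj₂ (inj₂ true)) h = h
    avoidsE (inj₂ (inj₂ false)) _ = tt

    avoidsV⁻¹ : ∀ v → liftV (λ a → ¬ S (inj₁ a)) v → ¬ S' (inj₁ v)
    avoidsV⁻¹ (inj₁ _) h = h
    avoidsV⁻¹ (inj₂ _) _ ()

    avoidsE⁻¹ : ∀ e → liftE (λ a → ¬ S (inj₂ a)) e → ¬ S' (inj₂ e)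
    avoidsE⁻¹ (inj₁ _) h = h
    avoidsE⁻¹ (inj₂ (inj₁ _)) _ ()
    avoidsE⁻¹ (inj₂ (inj₂ true)) h = h
    avoidsE⁻¹ (inj₂ (inj₂ false)) _ ()

    same-walks : (¬ AvoidingWalk G₁ S w₁ w₂) ⇔ (¬ AvoidingWalk G S' (inj₁ w₁) (inj₁ w₂))
    same-walks = mk⇔
      (λ none w → none (project (weaken avoidsV avoidsE w)))
      (λ none w → none (weaken avoidsV⁻¹ avoidsE⁻¹ (embed w)))

  -- If G has no cut-vertex, neither has G₁: project the walks avoiding inj₁ c.
  noCut-first : Joins G₁ e₁ u₁ v₁ → (∀ c → NoCutAt G c) → ∀ c → NoCutAt G₁ c
  noCut-first j₁ noCut c x y x≢c y≢c noWalk =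
    noCut (inj₁ c) (inj₁ x) (inj₁ y) (x≢c ∘ inj₁-injective) (y≢c ∘ inj₁-injective)
      (noWalk ∘ project ∘ weaken avoid (λ e _ → liftE-U e))
    where
    open Projection j₁
    avoid : ∀ v → inj₁ c ≢ v → liftV (c ≢_) v
    avoid (inj₁ _) c≢v = c≢v ∘ cong inj₁
    avoid (inj₂ _) _ = tt

  noCutAt-first : DecidableEquality (V G₁) → DecidableEquality (E G₁) → Joins G₁ e₁ u₁ v₁ →
    (∀ a b → RWalk G₂ U (e₂ ≢_) a b) → (∀ c → NoCutAt G₁ c) → ∀ c → NoCutAt G (inj₁ c)
  noCutAt-first decV₁ decE₁ j₁ links noCut₁ c = joined
    where
    open Embedding j₁ decE₁ (links u₂ v₂)

    avoiding : ∀ {x y} → RWalk G (liftV (c ≢_)) (liftE U) x y → RWalk G (inj₁ c ≢_) U x y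
    avoiding = weaken avoid (λ _ _ → tt)
      where
      avoid : ∀ v → liftV (c ≢_) v → inj₁ c ≢ v
      avoid (inj₁ _) c≢v = c≢v ∘ inj₁-injective
      avoid (inj₂ _) _ ()

    -- Leave G₁ − c through f, or through g if c = u₁.
    crossing : ∀ a b → a ≢ c → ¬ ¬ RWalk G (inj₁ c ≢_) U (inj₁ a) (inj₂ b)
    crossing a b a≢c noWalk with decV₁ c u₁
    ... | no c≢u₁ = noCut₁ c a u₁ a≢c (≢-sym c≢u₁) λ w →
      noWalk (avoiding (embed w ++ via f c≢u₁ tt (inj₁ refl) (lift₂ (links u₂ b))))
    ... | yes c≡u₁ = noCut₁ c a v₁ a≢c (≢-sym c≢v₁) λ w →
      noWalk (avoiding (embed w ++ via g c≢v₁ tt (inj₁ refl) (lift₂ (links v₂ b))))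
      where
      c≢v₁ : c ≢ v₁
      c≢v₁ c≡v₁ = joins-distinct {G₁} j₁ (trans (sym c≡u₁) c≡v₁)

    joined : NoCutAt G (inj₁ c)
    joined (inj₁ a) (inj₁ b) a≢c b≢c noWalk =
      noCut₁ c a b (a≢c ∘ cong inj₁) (b≢c ∘ cong inj₁) (noWalk ∘ avoiding ∘ embed)
    joined (inj₁ a) (inj₂ b) a≢c _ = crossing a b (a≢c ∘ cong inj₁)
    joined (inj₂ a) (inj₁ b) _ b≢c noWalk = crossing b a (b≢c ∘ cong inj₁) (noWalk ∘ reverse)
    joined (inj₂ a) (inj₂ b) _ _ noWalk = noWalk (avoiding (lift₂ (links a b)))

  -- G is connected: G₁ is, G₂ − e₂ is, and f joins them.
  connectivity : DecidableEquality (E G₁) → Joins G₁ e₁ u₁ v₁ →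
    (∀ a b → RWalk G₁ U U a b) → (∀ a b → RWalk G₂ U (e₂ ≢_) a b) → ∀ x y → RWalk G U U x y
  connectivity decE₁ j₁ walks₁ links = connect
    where
    open Embedding j₁ decE₁ (links u₂ v₂)

    forget : ∀ {x y} → RWalk G (liftV U) (liftE U) x y → RWalk G U U x y
    forget = weaken (λ _ _ → tt) (λ _ _ → tt)

    connect : ∀ x y → RWalk G U U x y
    connect (inj₁ a) (inj₁ b) = forget (embed (walks₁ a b))
    connect (inj₂ a) (inj₂ b) = forget (lift₂ (links a b))
    connect (inj₁ a) (inj₂ b) = forget (embed (walks₁ a u₁) ++ via f tt tt (inj₁ refl) (lift₂ (links u₂ b)))
    connect (inj₂ a) (inj₁ b) = reverse (connect (inj₁ b) (inj₂ a))

-- Cut-freeness of G restricts to the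
-- factors by projection; conversely a cut-vertex of G in G₁ would already cut
-- G₁.  The statements for G₂ are those for G₁ applied to the exchanged sum.
biconnectivity : (G₁ : Graph) (e₁ : E G₁) (u₁ v₁ : V G₁) (G₂ : Graph) (e₂ : E G₂) (u₂ v₂ : V G₂) →
  IsFinite G₁ → IsFinite G₂ → TwoEdgeConnected G₁ → TwoEdgeConnected G₂ →
  Joins G₁ e₁ u₁ v₁ → Joins G₂ e₂ u₂ v₂ →
  Biconnected (odotE G₁ e₁ u₁ v₁ G₂ e₂ u₂ v₂) ⇔ (Biconnected G₁ × Biconnected G₂)
biconnectivity G₁ e₁ u₁ v₁ G₂ e₂ u₂ v₂ (finV₁ , finE₁) (finV₂ , finE₂) tec₁ tec₂ j₁ j₂ =
  mk⇔ split merge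
  where
  module L = Odot G₁ e₁ u₁ v₁ G₂ e₂ u₂ v₂
  module R = Odot G₂ e₂ u₂ v₂ G₁ e₁ u₁ v₁

  decV₁ : DecidableEquality (V G₁)
  decV₁ = finite⇒decidable finV₁
  decV₂ : DecidableEquality (V G₂)
  decV₂ = finite⇒decidable finV₂
  decE₁ : DecidableEquality (E G₁)
  decE₁ = finite⇒decidable finE₁
  decE₂ : DecidableEquality (E G₂)
  decE₂ = finite⇒decidable finE₂
  decV : DecidableEquality (V L.G)
  decV = ≡-dec decV₁ decV₂

  split : Biconnected L.G → Biconnected G₁ × Biconnected G₂
  split (_ , noCutVertex) =
      (proj₁ tec₁ , λ c → NoCutAt⇒no-cut G₁ decV₁ c (L.noCut-first j₁ noCut c))
    , (proj₁ tec₂ , λ c → NoCutAt⇒no-cut G₂ decV₂ c (R.noCut-first j₂ noCut' c))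
    where
    noCut : ∀ c → NoCutAt L.G c
    noCut c = no-cut⇒NoCutAt L.G c (noCutVertex c)
    noCut' : ∀ c → NoCutAt R.G c
    noCut' c = L.noCutAt-exchange c (noCut (swap c))

  merge : Biconnected G₁ × Biconnected G₂ → Biconnected L.G
  merge ((conn₁ , noCutVertex₁) , (_ , noCutVertex₂)) =
      connected-of-walks L.G decV (inj₁ u₁)
        (L.connectivity decE₁ j₁ (walks-of-connected G₁ conn₁) (walks-avoiding G₂ tec₂ e₂))
    , λ c → NoCutAt⇒no-cut L.G decV c (noCut c)
    where
    noCut : ∀ c → NoCutAt L.G c
    noCut (inj₁ c) = L.noCutAt-first decV₁ decE₁ j₁ (walks-avoiding G₂ tec₂ e₂)
      (λ c' → no-cut⇒NoCutAt G₁ c' (noCutVertex₁ c')) c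
    noCut (inj₂ c) = R.noCutAt-exchange (inj₂ c) (R.noCutAt-first decV₂ decE₂ j₂ (walks-avoiding G₁ tec₁ e₁)
      (λ c' → no-cut⇒NoCutAt G₂ c' (noCutVertex₂ c')) c)

mainTheorem10 : (G₁ G₂ : Graph) → IsFinite G₁ → IsFinite G₂ →
    TwoEdgeConnected G₁ → TwoEdgeConnected G₂ →
    (e₁ : E G₁) (u₁ v₁ : V G₁) → Joins G₁ e₁ u₁ v₁ →
    (e₂ : E G₂) (u₂ v₂ : V G₂) → Joins G₂ e₂ u₂ v₂ →
    ((S : VESet G₁) (w₁ w₂ : V G₁) → w₁ ≢ w₂ →
      Separates G₁ S w₁ w₂ ⇔
      Separates (odotE G₁ e₁ u₁ v₁ G₂ e₂ u₂ v₂)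
        (liftSet G₁ e₁ u₁ v₁ G₂ e₂ u₂ v₂ S) (inj₁ w₁) (inj₁ w₂))
    × (Biconnected (odotE G₁ e₁ u₁ v₁ G₂ e₂ u₂ v₂) ⇔ (Biconnected G₁ × Biconnected G₂))
mainTheorem10 G₁ G₂ fin₁ fin₂ tec₁ tec₂ e₁ u₁ v₁ j₁ e₂ u₂ v₂ j₂ =
    (λ S w₁ w₂ _ → separation decV₁ decV₂ decE₁ j₁ (walks-avoiding G₂ tec₂ e₂ u₂ v₂) S w₁ w₂)
  , biconnectivity G₁ e₁ u₁ v₁ G₂ e₂ u₂ v₂ fin₁ fin₂ tec₁ tec₂ j₁ j₂
  where
  open Odot G₁ e₁ u₁ v₁ G₂ e₂ u₂ v₂ using (separation)
  decV₁ : DecidableEquality (V G₁)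
  decV₁ = finite⇒decidable (proj₁ fin₁)
  decV₂ : DecidableEquality (V G₂)
  decV₂ = finite⇒decidable (proj₁ fin₂)
  decE₁ : DecidableEquality (E G₁)
  decE₁ = finite⇒decidable (proj₂ fin₁)
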